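{- Let $a,b$ be integers with $|b|=1$, and suppose that $|a|$ has at least two distinct prime factors $p_1<p_2$. Let $(x_n)_{n\ge 0}$ be defined by $x_0=p_1^2$, $x_1=p_2^2$ and $x_{n+1}=ax_n+bx_{n-1}$ for $n\ge 1$. Then $x_0$ and $x_1$ are relatively prime positive integers and $|x_n|$ is composite for every $n\ge 0$.
   Context: A nonnegative integer $m$ is called composite if $m\neq 0,1$ and $m$ is not a prime number. -}

module Defs where

open import Data.Nat using (ℕ; zero; suc)
open import Data.Integer using (ℤ; _+_; _*_)

lucasSeq : (a b x₀ x₁ : ℤ) → ℕ → ℤ
lucasSeq a b x₀ x₁ zero = x₀
lucasSeq a b x₀ x₁ (suc zero) = x₁
lucasSeq a b x₀ x₁ (suc (suc n)) =
  a * lucasSeq a b x₀ x₁ (suc n) + b * lucasSeq a b x₀ x₁ n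

-- Every divisor of a that divides x_n also divides x_{n+2} = a x_{n+1} + b x_n, so p₁ divides
-- the terms of even index and p₂ those of odd index. Moreover |x_{n+2}| ≥ |x_n|: for a = 0 the
-- two are equal, and otherwise |a| ≥ 2 and |x_{n+2}| ≥ |a| |x_{n+1}| − |x_n| ≥ 2|x_{n+1}| − |x_n|
-- makes |x_n| nondecreasing from |x_0| = p₁² ≤ p₂² = |x_1|. So a prime p divides x_n with
-- p < p² ≤ |x_n|, i.e. p is a proper divisor of |x_n|.

{-# OPTIONS --safe #-}
module Submission where

open import Defs
open import Data.Nat using (ℕ; _<_; _^_)
open import Data.Nat.Divisibility using (_∣_)
open import Data.Nat.Primality using (Prime; Composite)
open import Data.Nat.Coprimality using (Coprime)
open import Data.Integer using (ℤ; +_; ∣_∣; _>_; 0ℤ)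
open import Data.Product using (_×_)
open import Relation.Binary.PropositionalEquality using (_≡_)

open import Data.Nat as ℕ using (zero; suc; _≤_)
import Data.Nat.Properties as ℕ
import Data.Nat.Divisibility as ℕ
import Data.Nat.Coprimality as Coprime
open import Data.Nat.Primality using (composite; prime; prime⇒nonZero)
open import Data.Integer as ℤ using (_+_; _*_; -_)
import Data.Integer.Properties as ℤ
import Data.Integer.Divisibility.Signed as ℤ
open import Data.Product using (_,_; ∃)
open import Data.Sum using (_⊎_; inj₁; inj₂)
open import Relation.Binary.PropositionalEquality using (_≢_; refl; sym; trans; cong; subst; subst₂; module ≡-Reasoning)
open import Relation.Nullary using (contradiction)

coprime-*ʳ : ∀ {m n k} → Coprime m n → Coprime m k → Coprime m (n ℕ.* k)
coprime-*ʳ {m} {n} cn ck (d∣m , d∣nk) = ck (d∣m , Coprime.coprime-divisor d⊥n d∣nk)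
  where
  d⊥n : Coprime _ n
  d⊥n (e∣d , e∣n) = cn (ℕ.∣-trans e∣d d∣m , e∣n)

coprime-^ʳ : ∀ {m n} k → Coprime m n → Coprime m (n ^ k)
coprime-^ʳ zero    _   = Coprime.sym (Coprime.1-coprimeTo _)
coprime-^ʳ (suc k) m⊥n = coprime-*ʳ m⊥n (coprime-^ʳ k m⊥n)

coprime-^ : ∀ {m n} k → Coprime m n → Coprime (m ^ k) (n ^ k)
coprime-^ k m⊥n = Coprime.sym (coprime-^ʳ k (Coprime.sym (coprime-^ʳ k m⊥n)))

prime⇒1<p : ∀ {p} → Prime p → 1 < p
prime⇒1<p {p} (prime _) = ℕ.nonTrivial⇒n>1 p

prime⇒p<p² : ∀ {p} → Prime p → p < p ^ 2
prime⇒p<p² {p} pp = subst (p <_) (cong (p ℕ.*_) (sym (ℕ.*-identityʳ p)))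
  (ℕ.m<m*n p p {{prime⇒nonZero pp}} (prime⇒1<p pp))

prime∣⇒≢1 : ∀ {p n} → Prime p → p ∣ n → n ≢ 1
prime∣⇒≢1 pp p∣n refl = ℕ.<⇒≢ (prime⇒1<p pp) (sym (ℕ.∣1⇒≡1 p∣n))

prime∣∧square≤⇒composite : ∀ {p n} → Prime p → p ∣ n → p ^ 2 ≤ n → Composite n
prime∣∧square≤⇒composite pp p∣n p²≤n =
  composite (ℕ.<-≤-trans (prime⇒p<p² pp) p²≤n) p∣n
  where instance _ = ℕ.n>1⇒nonTrivial (prime⇒1<p pp)

∣i∣≤∣i+j∣+∣j∣ : ∀ i j → ∣ i ∣ ≤ ∣ i + j ∣ ℕ.+ ∣ j ∣
∣i∣≤∣i+j∣+∣j∣ i j = subst (λ k → ∣ k ∣ ≤ ∣ i + j ∣ ℕ.+ ∣ j ∣) i+j-j≡i (ℤ.∣i-j∣≤∣i∣+∣j∣ (i + j) j)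
  where
  open ≡-Reasoning
  i+j-j≡i : (i + j) + - j ≡ i
  i+j-j≡i = begin
    (i + j) + - j ≡⟨ ℤ.+-assoc i j (- j) ⟩
    i + (j + - j) ≡⟨ cong (λ k → i + k) (ℤ.+-inverseʳ j) ⟩
    i + 0ℤ        ≡⟨ ℤ.+-identityʳ i ⟩
    i             ∎

∣i∣≢1⇒i≡0⊎2≤∣i∣ : ∀ i → ∣ i ∣ ≢ 1 → i ≡ 0ℤ ⊎ 2 ≤ ∣ i ∣
∣i∣≢1⇒i≡0⊎2≤∣i∣ (+ 0)              _    = inj₁ refl
∣i∣≢1⇒i≡0⊎2≤∣i∣ (+ 1)              ∣i∣≢1 = contradiction refl ∣i∣≢1
∣i∣≢1⇒i≡0⊎2≤∣i∣ (+ suc (suc _))    _    = inj₂ (ℕ.s≤s (ℕ.s≤s ℕ.z≤n))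
∣i∣≢1⇒i≡0⊎2≤∣i∣ ℤ.-[1+ 0 ]         ∣i∣≢1 = contradiction refl ∣i∣≢1
∣i∣≢1⇒i≡0⊎2≤∣i∣ ℤ.-[1+ suc _ ]     _    = inj₂ (ℕ.s≤s (ℕ.s≤s ℕ.z≤n))

module LucasSeq (a b x₀ x₁ : ℤ) where

  x : ℕ → ℤ
  x = lucasSeq a b x₀ x₁

  ∣x-step₂ : ∀ {d} n → d ℤ.∣ a → d ℤ.∣ x n → d ℤ.∣ x (2 ℕ.+ n)
  ∣x-step₂ n d∣a d∣xₙ = ℤ.∣m∣n⇒∣m+n (ℤ.∣m⇒∣m*n (x (suc n)) d∣a) (ℤ.∣n⇒∣m*n b d∣xₙ)

  module _ (∣b∣≡1 : ∣ b ∣ ≡ 1) where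

    ∣b*i∣≡∣i∣ : ∀ i → ∣ b * i ∣ ≡ ∣ i ∣
    ∣b*i∣≡∣i∣ i = trans (ℤ.abs-* b i) (trans (cong (ℕ._* ∣ i ∣) ∣b∣≡1) (ℕ.*-identityˡ ∣ i ∣))

    ∣a∣*∣xₙ₊₁∣≤∣xₙ₊₂∣+∣xₙ∣ : ∀ n → ∣ a ∣ ℕ.* ∣ x (suc n) ∣ ≤ ∣ x (2 ℕ.+ n) ∣ ℕ.+ ∣ x n ∣
    ∣a∣*∣xₙ₊₁∣≤∣xₙ₊₂∣+∣xₙ∣ n = subst₂ (λ l r → l ≤ ∣ x (2 ℕ.+ n) ∣ ℕ.+ r)
      (ℤ.abs-* a (x (suc n))) (∣b*i∣≡∣i∣ (x n)) (∣i∣≤∣i+j∣+∣j∣ (a * x (suc n)) (b * x n))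

    ∣x∣-mono : 2 ≤ ∣ a ∣ → ∣ x₀ ∣ ≤ ∣ x₁ ∣ → ∀ n → ∣ x n ∣ ≤ ∣ x (suc n) ∣
    ∣x∣-mono 2≤∣a∣ ∣x₀∣≤∣x₁∣ zero    = ∣x₀∣≤∣x₁∣
    ∣x∣-mono 2≤∣a∣ ∣x₀∣≤∣x₁∣ (suc n) = ℕ.+-cancelʳ-≤ y y X (begin
      y ℕ.+ y          ≡⟨ cong (y ℕ.+_) (sym (ℕ.+-identityʳ y)) ⟩
      2 ℕ.* y          ≤⟨ ℕ.*-monoˡ-≤ y 2≤∣a∣ ⟩
      ∣ a ∣ ℕ.* y      ≤⟨ ∣a∣*∣xₙ₊₁∣≤∣xₙ₊₂∣+∣xₙ∣ n ⟩
      X ℕ.+ ∣ x n ∣    ≤⟨ ℕ.+-monoʳ-≤ X (∣x∣-mono 2≤∣a∣ ∣x₀∣≤∣x₁∣ n) ⟩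
      X ℕ.+ y          ∎)
      where
      open ℕ.≤-Reasoning
      y = ∣ x (suc n) ∣
      X = ∣ x (2 ℕ.+ n) ∣

    a≡0⇒∣xₙ₊₂∣≡∣xₙ∣ : a ≡ 0ℤ → ∀ n → ∣ x (2 ℕ.+ n) ∣ ≡ ∣ x n ∣
    a≡0⇒∣xₙ₊₂∣≡∣xₙ∣ a≡0 n = begin
      ∣ a * x (suc n) + b * x n ∣    ≡⟨ cong (λ c → ∣ c * x (suc n) + b * x n ∣) a≡0 ⟩
      ∣ 0ℤ * x (suc n) + b * x n ∣   ≡⟨ cong ∣_∣ (ℤ.+-identityˡ (b * x n)) ⟩
      ∣ b * x n ∣                    ≡⟨ ∣b*i∣≡∣i∣ (x n) ⟩
      ∣ x n ∣                        ∎
      where open ≡-Reasoning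

    ∣x∣-mono₂ : ∣ a ∣ ≢ 1 → ∣ x₀ ∣ ≤ ∣ x₁ ∣ → ∀ n → ∣ x n ∣ ≤ ∣ x (2 ℕ.+ n) ∣
    ∣x∣-mono₂ ∣a∣≢1 ∣x₀∣≤∣x₁∣ n with ∣i∣≢1⇒i≡0⊎2≤∣i∣ a ∣a∣≢1
    ... | inj₁ a≡0    = ℕ.≤-reflexive (sym (a≡0⇒∣xₙ₊₂∣≡∣xₙ∣ a≡0 n))
    ... | inj₂ 2≤∣a∣ = ℕ.≤-trans (∣x∣-mono 2≤∣a∣ ∣x₀∣≤∣x₁∣ n) (∣x∣-mono 2≤∣a∣ ∣x₀∣≤∣x₁∣ (suc n))

lemma5p1 : (a b : ℤ) → ∣ b ∣ ≡ 1 → (p₁ p₂ : ℕ) → Prime p₁ → Prime p₂ → p₁ < p₂ → p₁ ∣ (∣ a ∣) → p₂ ∣ (∣ a ∣) →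
    let x = lucasSeq a b (+ (p₁ ^ 2)) (+ (p₂ ^ 2)) in
    (x 0 > 0ℤ × x 1 > 0ℤ × Coprime (∣ x 0 ∣) (∣ x 1 ∣)) × (∀ (n : ℕ) → Composite (∣ x n ∣))
lemma5p1 a b ∣b∣≡1 p₁ p₂ pp₁ pp₂ p₁<p₂ p₁∣a p₂∣a =
  (square>0 pp₁ , square>0 pp₂ , coprime-^ 2 p₁⊥p₂) , composite-xₙ
  where
  open LucasSeq a b (+ (p₁ ^ 2)) (+ (p₂ ^ 2))

  square>0 : ∀ {p} → Prime p → + (p ^ 2) > 0ℤ
  square>0 pp = ℤ.+<+ (ℕ.<-trans (ℕ.<-trans ℕ.0<1+n (prime⇒1<p pp)) (prime⇒p<p² pp))

  p₁⊥p₂ : Coprime p₁ p₂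
  p₁⊥p₂ = Coprime.sym (Coprime.prime⇒coprime pp₂ {{prime⇒nonZero pp₁}} p₁<p₂)

  ∣x₀∣≤∣x₁∣ : p₁ ^ 2 ≤ p₂ ^ 2
  ∣x₀∣≤∣x₁∣ = ℕ.<⇒≤ (ℕ.^-monoˡ-< 2 p₁<p₂)

  LargePrimeDivisor : ℕ → Set
  LargePrimeDivisor n = ∃ λ p → Prime p × p ∣ ∣ a ∣ × + p ℤ.∣ x n × p ^ 2 ≤ ∣ x n ∣

  large-prime-divisor : ∀ n → LargePrimeDivisor n
  large-prime-divisor 0 = p₁ , pp₁ , p₁∣a , ℤ.∣ᵤ⇒∣ (ℕ.m∣m*n (p₁ ^ 1)) , ℕ.≤-refl
  large-prime-divisor 1 = p₂ , pp₂ , p₂∣a , ℤ.∣ᵤ⇒∣ (ℕ.m∣m*n (p₂ ^ 1)) , ℕ.≤-refl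
  large-prime-divisor (suc (suc n)) with large-prime-divisor n
  ... | p , pp , p∣a , p∣xₙ , p²≤∣xₙ∣ =
    p , pp , p∣a , ∣x-step₂ n (ℤ.∣ᵤ⇒∣ p∣a) p∣xₙ ,
    ℕ.≤-trans p²≤∣xₙ∣ (∣x∣-mono₂ ∣b∣≡1 (prime∣⇒≢1 pp₁ p₁∣a) ∣x₀∣≤∣x₁∣ n)

  composite-xₙ : ∀ n → Composite ∣ x n ∣
  composite-xₙ n with large-prime-divisor n
  ... | p , pp , _ , p∣xₙ , p²≤∣xₙ∣ = prime∣∧square≤⇒composite pp (ℤ.∣⇒∣ᵤ p∣xₙ) p²≤∣xₙ∣
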